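{- Let $Q$ be an orbit-finite equivariant set with the integer atoms and $\equiv$ an equivariant equivalence relation on $Q$. Define a relation $[\equiv]$ on the orbits of $Q$ by: $\tau_1\,[\equiv]\,\tau_2$ iff $q_1\equiv q_2$ for some $q_1\in\tau_1$ and some $q_2\in\tau_2$. Then $[\equiv]$ is an equivalence relation.
   Context: Integer atoms: the atoms are $\mathbb{Z}$ with successor; the automorphisms are the translations $x\mapsto x+z$, acting hereditarily on sets built from atoms (on pairs componentwise). A set or relation is equivariant if invariant under all translations. The orbit of $x$ is $\{x\cdot\pi : \pi\text{ a translation}\}$; an equivariant set is orbit-finite if it is a finite union of orbits. -}

module Defs where

open import Data.Integer using (ℤ; _+_; 0ℤ)
open import Data.Nat using (ℕ)
open import Data.Fin using (Fin)
open import Data.Product using (Σ; ∃; ∃-syntax; _×_; _,_)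
open import Function.Bundles using (_⇔_)
open import Relation.Binary.PropositionalEquality using (_≡_)

-- An equivariant set over the integer atoms: a set with an action of the
-- automorphism group (ℤ,+) of the integer atoms, i.e. the translations
-- x ↦ x + z.  act q z is q·π for π the translation by z.
record ZSet : Set₁ where
  field
    Carrier : Set
    act     : Carrier → ℤ → Carrier
    act-id  : ∀ q → act q 0ℤ ≡ q
    act-∘   : ∀ q a b → act (act q a) b ≡ act q (a + b)
open ZSet public

module _ (Q : ZSet) where
  private X = Carrier Q

  InOrbit : X → X → Set
  InOrbit x y = ∃[ z ] (y ≡ act Q x z)

  OrbitFinite : Set
  OrbitFinite = Σ ℕ λ n → Σ (Fin n → X) λ reps → ∀ q → ∃[ i ] InOrbit (reps i) q

  EquivariantRel : (X → X → Set) → Set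
  EquivariantRel R = ∀ p q z → R p q → R (act Q p z) (act Q q z)

  Orbit : Set₁
  Orbit = Σ (X → Set) λ O → ∃[ x ] (∀ y → O y ⇔ InOrbit x y)

  liftRel : (X → X → Set) → Orbit → Orbit → Set
  liftRel R (O₁ , _) (O₂ , _) = ∃[ q₁ ] ∃[ q₂ ] (O₁ q₁ × O₂ q₂ × R q₁ q₂)

module Submission where

-- Reflexivity holds because every orbit is inhabited (by its representative)
-- and ≈ is reflexive; symmetry is inherited directly from ≈.  Transitivity is
-- the only step using equivariance: given q₁ ≈ q₂ and q₂' ≈ q₃ with q₂, q₂' in
-- the same orbit, write q₂' = q₂·z; translating the first witness by z gives
-- q₁·z ≈ q₂' (equivariance), with q₁·z still in the orbit of q₁, so that
-- q₁·z ≈ q₃ by transitivity of ≈.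

open import Defs
open import Relation.Binary.Structures using (IsEquivalence)
open import Data.Integer using (_+_; -_; 0ℤ)
open import Data.Integer.Properties using (+-assoc; +-inverseʳ; +-identityˡ)
open import Data.Product using (∃-syntax; _×_; _,_; proj₁)
open import Function.Bundles using (Equivalence)
open import Relation.Binary.PropositionalEquality
  using (_≡_; sym; trans; cong; subst; module ≡-Reasoning)

translate-difference : ∀ a b → a + (- a + b) ≡ b
translate-difference a b = begin
  a + (- a + b)  ≡⟨ sym (+-assoc a (- a) b) ⟩
  a + - a + b    ≡⟨ cong (_+ b) (+-inverseʳ a) ⟩
  0ℤ + b         ≡⟨ +-identityˡ b ⟩
  b              ∎
  where open ≡-Reasoning

module OrbitFacts (Q : ZSet) where
  private X = Carrier Q

  _∈ₒ_ : X → Orbit Q → Set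
  y ∈ₒ o = proj₁ o y

  common-orbit : ∀ {x y y'} → InOrbit Q x y → InOrbit Q x y' → InOrbit Q y y'
  common-orbit {x} {y} {y'} (a , y≡xa) (b , y'≡xb) = - a + b , (begin
    y'                       ≡⟨ y'≡xb ⟩
    act Q x b                ≡⟨ cong (act Q x) (sym (translate-difference a b)) ⟩
    act Q x (a + (- a + b))  ≡⟨ sym (act-∘ Q x a (- a + b)) ⟩
    act Q (act Q x a) (- a + b) ≡⟨ cong (λ w → act Q w (- a + b)) (sym y≡xa) ⟩
    act Q y (- a + b)        ∎)
    where open ≡-Reasoning

  orbit-inhabited : (o : Orbit Q) → ∃[ x ] (x ∈ₒ o)
  orbit-inhabited (O , x , O⇔) = x , Equivalence.from (O⇔ x) (0ℤ , sym (act-id Q x))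

  orbit-closed : (o : Orbit Q) → ∀ {y} → y ∈ₒ o → ∀ z → act Q y z ∈ₒ o
  orbit-closed (O , x , O⇔) {y} y∈o z with Equivalence.to (O⇔ y) y∈o
  ... | a , y≡xa = Equivalence.from (O⇔ (act Q y z))
        (a + z , trans (cong (λ w → act Q w z) y≡xa) (act-∘ Q x a z))

  orbit-connected : (o : Orbit Q) → ∀ {y y'} → y ∈ₒ o → y' ∈ₒ o → InOrbit Q y y'
  orbit-connected (O , x , O⇔) {y} {y'} y∈o y'∈o =
    common-orbit (Equivalence.to (O⇔ y) y∈o) (Equivalence.to (O⇔ y') y'∈o)

  realign : (R : X → X → Set) → EquivariantRel Q R →
            (o₁ o₂ : Orbit Q) → ∀ {q₁ q₂ q₂'} →
            q₁ ∈ₒ o₁ → q₂ ∈ₒ o₂ → q₂' ∈ₒ o₂ → R q₁ q₂ →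
            ∃[ q₁' ] (q₁' ∈ₒ o₁ × R q₁' q₂')
  realign R equivariant o₁ o₂ {q₁} {q₂} q₁∈o₁ q₂∈o₂ q₂'∈o₂ q₁Rq₂
    with orbit-connected o₂ q₂∈o₂ q₂'∈o₂
  ... | z , q₂'≡q₂z =
    act Q q₁ z , orbit-closed o₁ q₁∈o₁ z ,
    subst (R (act Q q₁ z)) (sym q₂'≡q₂z) (equivariant q₁ q₂ z q₁Rq₂)

lemma6 : (Q : ZSet) → OrbitFinite Q → (_≈_ : Carrier Q → Carrier Q → Set) →
         EquivariantRel Q _≈_ → IsEquivalence _≈_ →
         IsEquivalence (liftRel Q _≈_)
lemma6 Q _ _≈_ equivariant isEquiv = record
  { refl  = λ {o} → lift-refl o
  ; sym   = λ {o₁} {o₂} → lift-sym o₁ o₂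
  ; trans = λ {o₁} {o₂} {o₃} → lift-trans o₁ o₂ o₃
  }
  where
  open OrbitFacts Q
  module ≈ = IsEquivalence isEquiv
  _[≈]_ : Orbit Q → Orbit Q → Set
  _[≈]_ = liftRel Q _≈_

  lift-refl : ∀ o → o [≈] o
  lift-refl o with orbit-inhabited o
  ... | x , x∈o = x , x , x∈o , x∈o , ≈.refl

  lift-sym : ∀ o₁ o₂ → o₁ [≈] o₂ → o₂ [≈] o₁
  lift-sym o₁ o₂ (q₁ , q₂ , q₁∈o₁ , q₂∈o₂ , q₁≈q₂) = q₂ , q₁ , q₂∈o₂ , q₁∈o₁ , ≈.sym q₁≈q₂

  -- move the first witness pair so that its o₂-end is the o₂-end of the second
  lift-trans : ∀ o₁ o₂ o₃ → o₁ [≈] o₂ → o₂ [≈] o₃ → o₁ [≈] o₃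
  lift-trans o₁ o₂ o₃ (q₁ , q₂ , q₁∈o₁ , q₂∈o₂ , q₁≈q₂) (q₂' , q₃ , q₂'∈o₂ , q₃∈o₃ , q₂'≈q₃)
    with realign _≈_ equivariant o₁ o₂ q₁∈o₁ q₂∈o₂ q₂'∈o₂ q₁≈q₂
  ... | q₁' , q₁'∈o₁ , q₁'≈q₂' = q₁' , q₃ , q₁'∈o₁ , q₃∈o₃ , ≈.trans q₁'≈q₂' q₂'≈q₃
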